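{- Let $\mathcal{M}$ be an automaton, and consider a counting automaton of $\mathcal{M}$ presented with transitions in parallel. For each visible state $q$, let $f_1^q(z), f_2^q(z),\ldots$ be the transitions in parallel leaving $q$. If for every visible state $q$ the series $F^q(z)=\sum_{k\ge 1} f_k^q(z)$ is a convergent series (i.e. for every $n$ the coefficient of $z^n$ in this sum is a finite sum, so $F^q(z)$ is a well-defined formal power series with coefficients in $\mathbb{N}$), then $\mathcal{M}$ is convergent, i.e. $L^{(n)}(\mathcal{M})$ is finite for every $n\ge 0$.
   Context: An automaton is a 5-tuple $\mathcal{M}=(\Sigma,Q,q_0,F,E)$ ($\Sigma$ alphabet, $Q$ states, $q_0$ initial state, $F\neq\emptyset$ final states, $E\subseteq Q\times\Sigma\times Q$ transitions; all possibly infinite). $L^{(n)}(\mathcal{M})$ is the number of paths of $n$ transitions from $q_0$ to a final state (words of length $n$ recognized, counted with repetition); $\mathcal{M}$ is convergent if $L^{(n)}(\mathcal{M})<\infty$ for all $n$. The counting automaton of $\mathcal{M}$ replaces each transition label by $z$. A transition in parallel from state $p$ to state $q$ labelled by a formal power series $f(z)=\sum_{n\ge1} f_nz^n$ with $f_n\in\mathbb{N}$ is a compact notation for the following subgraph of a counting automaton: for each $n\ge1$ there are $f_n$ disjoint chains of $n$ transitions labelled $z$ from $p$ to $q$, each chain passing through $n-1$ intermediate states which are not final and from each of which exactly one transition starts (the next one in its chain). The states $p,q$ are called visible states and the intermediate states hidden states. A counting automaton is presented with transitions in parallel when all its transitions are grouped into transitions in parallel between visible states (an ordinary transition labelled $z$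 being the transition in parallel $f(z)=z$). -}

module Defs where

open import Level using (0ℓ)
open import Data.Nat using (ℕ; zero; suc; _<_)
open import Data.Fin using (Fin; zero; suc; inject₁)
open import Data.Maybe using (Maybe; just; nothing; maybe)
open import Data.Vec using (Vec; []; _∷_)
open import Data.List using (List)
open import Data.List.Membership.Propositional using (_∈_)
open import Data.Product using (Σ; ∃; _×_; _,_)
open import Data.Sum using (_⊎_; inj₁; inj₂)
open import Data.Empty using (⊥)
open import Relation.Binary.PropositionalEquality using (_≡_)
open import Function.Bundles using (_↔_; _⇔_; Inverse; Equivalence)

-- Automata M = (Σ, Q, q₀, F, E), all components possibly infinite.
-- E ⊆ Q × Σ × Q is represented by a type of transitions together with
-- source / label / target maps which are jointly injective.

record Automaton : Set₁ where
  field
    Alph     : Set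
    Q        : Set
    q₀       : Q
    Final    : Q → Set
    Final≠∅  : ∃ Final
    E        : Set
    src      : E → Q
    lbl      : E → Alph
    tgt      : E → Q
    E-subset : ∀ e e′ → src e ≡ src e′ → lbl e ≡ lbl e′ → tgt e ≡ tgt e′ → e ≡ e′

-- Counting automata: all labels are z, so only the (multi)graph remains.

record CountingAutomaton : Set₁ where
  field
    Q     : Set
    q₀    : Q
    Final : Q → Set
    E     : Set
    src   : E → Q
    tgt   : E → Q

countingAutomaton : Automaton → CountingAutomaton
countingAutomaton M = record
  { Q = Q ; q₀ = q₀ ; Final = Final ; E = E ; src = src ; tgt = tgt }
  where open Automaton M

module _ (A : CountingAutomaton) where
  open CountingAutomaton A

  PathFromTo : {n : ℕ} → Q → Vec E n → Q → Set
  PathFromTo q []       q′ = q ≡ q′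
  PathFromTo q (e ∷ es) q′ = (src e ≡ q) × PathFromTo (tgt e) es q′

  Accepting : {n : ℕ} → Vec E n → Set
  Accepting es = Σ Q λ q′ → PathFromTo q₀ es q′ × Final q′

  CountingConvergent : Set
  CountingConvergent = ∀ n → ∃ λ (ws : List (Vec E n)) →
    ∀ (es : Vec E n) → Accepting es → es ∈ ws

-- M is convergent: L⁽ⁿ⁾(M) < ∞ for every n (paths of M are the paths
-- of its counting automaton, labels being irrelevant for counting).
Convergent : Automaton → Set
Convergent M = CountingConvergent (countingAutomaton M)

-- V : visible states; K q : index set of the transitions in parallel
-- f₁^q, f₂^q, … leaving q; target q k its target visible state;
-- coeff q k m = coefficient of z^(m+1) in f_k^q(z)
-- (the series have no constant term).

record ParallelPresentation : Set₁ where
  field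
    V       : Set
    v₀      : V
    VFinal  : V → Set
    K       : V → Set
    target  : (q : V) → K q → V
    coeff   : (q : V) → K q → ℕ → ℕ

-- F^q(z) = Σ_k f_k^q(z) is convergent: for every n ≥ 1 only finitely
-- many k have a nonzero coefficient of z^n in f_k^q (so the coefficient
-- of z^n in F^q is a finite sum of naturals).
ParallelConvergent : ParallelPresentation → Set
ParallelConvergent P = ∀ (q : V) (m : ℕ) → ∃ λ (ks : List (K q)) →
  ∀ (k : K q) → 0 < coeff q k m → k ∈ ks
  where open ParallelPresentation P

-- inner m p : for a position p ∈ {1,…,m+1} (encoded p-1 : Fin (m+1)) of
-- a chain of length m+1, nothing if it is the last position, otherwise
-- the index of the hidden state.
inner : (m : ℕ) → Fin (suc m) → Maybe (Fin m)
inner zero    zero    = nothing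
inner (suc m) zero    = just zero
inner (suc m) (suc i) = Data.Maybe.map suc (inner m i)

-- The counting automaton described by a presentation with transitions
-- in parallel: for each q, k, m and each j < coeff q k m, a chain of
-- m+1 transitions from q to target q k through m hidden states.
module _ (P : ParallelPresentation) where
  open ParallelPresentation P

  Chain : Set
  Chain = Σ V λ q → Σ (K q) λ k → Σ ℕ λ m → Fin (coeff q k m)

  chainLen : Chain → ℕ
  chainLen (_ , _ , m , _) = suc m

  HiddenState : Set
  HiddenState = Σ Chain λ c → Fin (Data.Nat.pred (chainLen c))

  PState : Set
  PState = V ⊎ HiddenState

  position : (c : Chain) → Fin (suc (chainLen c)) → PState
  position (q , k , m , j) zero    = inj₁ q
  position (q , k , m , j) (suc p) =
    maybe (λ i → inj₂ ((q , k , m , j) , i)) (inj₁ (target q k)) (inner m p)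

  PEdge : Set
  PEdge = Σ Chain λ c → Fin (chainLen c)

  PFinal : PState → Set
  PFinal (inj₁ v) = VFinal v
  PFinal (inj₂ _) = ⊥

  unfold : CountingAutomaton
  unfold = record
    { Q     = PState
    ; q₀    = inj₁ v₀
    ; Final = PFinal
    ; E     = PEdge
    ; src   = λ { (c , t) → position c (inject₁ t) }
    ; tgt   = λ { (c , t) → position c (suc t) }
    }

record _≅_ (A B : CountingAutomaton) : Set where
  module A = CountingAutomaton A
  module B = CountingAutomaton B
  field
    stateIso : A.Q ↔ B.Q
    edgeIso  : A.E ↔ B.E
    src-hom  : ∀ e → B.src (Inverse.to edgeIso e) ≡ Inverse.to stateIso (A.src e)
    tgt-hom  : ∀ e → B.tgt (Inverse.to edgeIso e) ≡ Inverse.to stateIso (A.tgt e)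
    init-hom : Inverse.to stateIso A.q₀ ≡ B.q₀
    final-hom : ∀ q → A.Final q ⇔ B.Final (Inverse.to stateIso q)

PresentedBy : Automaton → ParallelPresentation → Set
PresentedBy M P = countingAutomaton M ≅ unfold P

-- A path ending in a visible state must run through every chain it enters, so a
-- path of length n can only enter chains of length at most n. Out of a visible
-- state q there are, by convergence of F^q, only finitely many chains of length
-- at most n, and out of a hidden state there is exactly one transition. Hence at
-- every step of a path with n transitions left there are finitely many choices,
-- and the accepting paths of length n can be enumerated. Isomorphic counting
-- automata have the same numbers of paths, so this transfers to M.
module Submission where

open import Defs
open import Data.Nat using (ℕ; zero; suc; pred; _≤_; _∸_; z≤n; s≤s; >-nonZero⁻¹)
open import Data.Nat.Properties using (≤-trans; ≤-refl; n∸n≡0)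
open import Data.Fin using (Fin; zero; suc; inject₁; toℕ)
open import Data.Fin.Properties using (nonZeroIndex)
open import Data.Maybe using (just; nothing; maybe)
open import Data.Vec using (Vec; []; _∷_)
import Data.Vec as Vec
open import Data.Vec.Properties using (map-∘; map-cong; map-id)
open import Data.List using (List; _∷_; [_]; map; concatMap; upTo; allFin)
open import Data.List.Membership.Propositional using (_∈_; lose)
open import Data.List.Membership.Propositional.Properties
  using (∈-map⁺; ∈-concatMap⁺; ∈-upTo⁺; ∈-allFin)
open import Data.List.Relation.Unary.Any using (here)
open import Data.Product using (∃; Σ; _×_; _,_; proj₁; proj₂)
open import Data.Sum using (inj₁; inj₂)
open import Relation.Binary.PropositionalEquality
  using (_≡_; refl; sym; trans; cong; subst)
open import Function.Bundles using (Inverse; Equivalence)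

module _ (A : CountingAutomaton) where
  open CountingAutomaton A

  ReachesFinal : {n : ℕ} → Q → Vec E n → Set
  ReachesFinal q es = Σ Q λ q′ → PathFromTo A q es q′ × Final q′

  BoundedBranching : Set
  BoundedBranching = ∀ q n → ∃ λ (choices : List E) →
    ∀ e (es : Vec E n) → src e ≡ q → ReachesFinal (tgt e) es → e ∈ choices

  boundedBranching⇒convergent : BoundedBranching → CountingConvergent A
  boundedBranching⇒convergent branching n = pathsFrom q₀ n , pathsFrom-complete q₀
    where
    pathsFrom : Q → (n : ℕ) → List (Vec E n)
    pathsFrom q zero    = [ [] ]
    pathsFrom q (suc n) =
      concatMap (λ e → map (e ∷_) (pathsFrom (tgt e) n)) (proj₁ (branching q n))

    pathsFrom-complete : ∀ {n} q (es : Vec E n) → ReachesFinal q es → es ∈ pathsFrom q n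
    pathsFrom-complete q []       _                        = here refl
    pathsFrom-complete q (e ∷ es) (q′ , (src≡q , path) , final) =
      ∈-concatMap⁺ (λ e → map (e ∷_) (pathsFrom (tgt e) _))
        (lose (proj₂ (branching q _) e es src≡q (q′ , path , final))
              (∈-map⁺ (e ∷_) (pathsFrom-complete (tgt e) es (q′ , path , final))))

  rank≤length : (rank : Q → ℕ) →
    (∀ e → rank (src e) ≤ suc (rank (tgt e))) → (∀ q → Final q → rank q ≡ 0) →
    ∀ {n} q (es : Vec E n) → ReachesFinal q es → rank q ≤ n
  rank≤length rank step final≡0 q [] (q′ , refl , final) rewrite final≡0 q final = z≤n
  rank≤length rank step final≡0 q (e ∷ es) (q′ , (refl , path) , final) =
    ≤-trans (step e) (s≤s (rank≤length rank step final≡0 (tgt e) es (q′ , path , final)))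

≅-reflects-convergent : ∀ {A B} → A ≅ B → CountingConvergent B → CountingConvergent A
≅-reflects-convergent {A} {B} A≅B convergentB n
  with ws , complete ← convergentB n =
  map (Vec.map fromE) ws , λ es (q′ , path , final) →
    subst (_∈ map (Vec.map fromE) ws) (fromE∘toE es)
      (∈-map⁺ (Vec.map fromE) (complete (Vec.map toE es)
        (toS q′ , subst (λ s → PathFromTo B s (Vec.map toE es) (toS q′)) init-hom
                        (path-to _ es q′ path)
                , Equivalence.to (final-hom q′) final)))
  where
  open _≅_ A≅B
  toS = Inverse.to stateIso
  toE = Inverse.to edgeIso
  fromE = Inverse.from edgeIso

  path-to : ∀ {n} q (es : Vec A.E n) q′ → PathFromTo A q es q′ →
    PathFromTo B (toS q) (Vec.map toE es) (toS q′)
  path-to q []       q′ refl           = refl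
  path-to q (e ∷ es) q′ (refl , path) =
    src-hom e , subst (λ s → PathFromTo B s (Vec.map toE es) (toS q′)) (sym (tgt-hom e))
                      (path-to (A.tgt e) es q′ path)

  fromE∘toE : ∀ {n} (es : Vec A.E n) → Vec.map fromE (Vec.map toE es) ≡ es
  fromE∘toE es = trans (sym (map-∘ fromE toE es))
    (trans (map-cong (Inverse.strictlyInverseʳ edgeIso) es) (map-id es))

inner-inject₁ : ∀ m (t : Fin m) → inner m (inject₁ t) ≡ just t
inner-inject₁ (suc m) zero    = refl
inner-inject₁ (suc m) (suc t) rewrite inner-inject₁ m t = refl

-- Reading nothing as the last position m, inner m is the identity on positions.
toℕ-inner : ∀ m (p : Fin (suc m)) → maybe toℕ m (inner m p) ≡ toℕ p
toℕ-inner zero    zero    = refl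
toℕ-inner (suc m) zero    = refl
toℕ-inner (suc m) (suc p) with inner m p | toℕ-inner m p
... | just _  | eq = cong suc eq
... | nothing | eq = cong suc eq

∸-suc-≤ : ∀ m a → m ∸ a ≤ suc (m ∸ suc a)
∸-suc-≤ zero    zero    = z≤n
∸-suc-≤ zero    (suc a) = z≤n
∸-suc-≤ (suc m) zero    = s≤s ≤-refl
∸-suc-≤ (suc m) (suc a) = ∸-suc-≤ m a

module _ (P : ParallelPresentation) where
  open ParallelPresentation P
  open CountingAutomaton (unfold P) using (src; tgt)

  -- Transitions left until the end of the current chain; hidden state i sits at
  -- position i + 1 of a chain of length m + 1.
  remaining : PState P → ℕ
  remaining (inj₁ _)                     = 0
  remaining (inj₂ ((_ , _ , m , _) , i)) = m ∸ toℕ i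

  remaining-position : ∀ q k m j (p : Fin (suc m)) →
    remaining (position P (q , k , m , j) (suc p)) ≡ m ∸ toℕ p
  remaining-position q k m j p with inner m p | toℕ-inner m p
  ... | just i  | i≡p = cong (m ∸_) i≡p
  ... | nothing | m≡p = sym (trans (cong (m ∸_) (sym m≡p)) (n∸n≡0 m))

  src-inner-edge : ∀ c (t : Fin (pred (chainLen P c))) → src (c , suc t) ≡ inj₂ (c , t)
  src-inner-edge (q , k , m , j) t rewrite inner-inject₁ m t = refl

  remaining-step : ∀ e → remaining (src e) ≤ suc (remaining (tgt e))
  remaining-step (c , zero) = z≤n
  remaining-step (c@(q , k , m , j) , suc t)
    rewrite src-inner-edge c t | remaining-position q k m j (suc t) = ∸-suc-≤ m (toℕ t)

  remaining-final : ∀ s → PFinal P s → remaining s ≡ 0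
  remaining-final (inj₁ _) _ = refl

  entered-chain-length : ∀ q k m j {n} (es : Vec (PEdge P) n) →
    ReachesFinal (unfold P) (tgt ((q , k , m , j) , zero)) es → m ≤ n
  entered-chain-length q k m j es reaches =
    subst (_≤ _) (remaining-position q k m j zero)
      (rank≤length (unfold P) remaining remaining-step remaining-final _ es reaches)

  module _ (convergent : ParallelConvergent P) where

    chainsUpTo : (q : V) → ℕ → List (Chain P)
    chainsUpTo q n = concatMap (λ m → concatMap (λ k →
      map (λ j → q , k , m , j) (allFin (coeff q k m))) (proj₁ (convergent q m))) (upTo (suc n))

    choices : PState P → ℕ → List (PEdge P)
    choices (inj₁ q)       n = map (_, zero) (chainsUpTo q n)
    choices (inj₂ (c , i)) n = [ (c , suc i) ]

    choices-complete : ∀ e {n} (es : Vec (PEdge P) n) →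
      ReachesFinal (unfold P) (tgt e) es → e ∈ choices (src e) n
    choices-complete ((q , k , m , j) , zero) es reaches =
      ∈-map⁺ (_, zero)
        (∈-concatMap⁺ _ (lose (∈-upTo⁺ (s≤s (entered-chain-length q k m j es reaches)))
          (∈-concatMap⁺ _ (lose (proj₂ (convergent q m) k (>-nonZero⁻¹ _ {{nonZeroIndex j}}))
            (∈-map⁺ _ (∈-allFin j))))))
    choices-complete (c , suc t) es reaches rewrite src-inner-edge c t = here refl

    unfold-boundedBranching : BoundedBranching (unfold P)
    unfold-boundedBranching s n =
      choices s n , λ { e es refl reaches → choices-complete e es reaches }

mainTheorem2 : (M : Automaton) (P : ParallelPresentation) →
    PresentedBy M P → ParallelConvergent P → Convergent M
mainTheorem2 M P M≅P convergent =
  ≅-reflects-convergent M≅P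
    (boundedBranching⇒convergent (unfold P) (unfold-boundedBranching P convergent))
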